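{- Let $n\geq 3$ and $2\leq k\leq\binom{n}{2}$, let $p$ be the integer with $k\binom{p}{2}\leq\binom{n}{2}<k\binom{p+1}{2}$, and let $q,r$ be the uniquely determined nonnegative integers with $\binom{n}{2}=k\binom{p}{2}+qp+r$, $0\leq q<k$, $0\leq r<p$. Then $$M(k,n)\leq\begin{cases} kp-k+q & \text{if } r\leq (p-1)/2,\\ kp-k+q+1-\frac{2(p-r)}{p+1} & \text{if } r\geq (p-1)/2.\end{cases}$$ Moreover, equality holds whenever $K_n$ admits an edge decomposition into: $q$ copies of $K_{p+1}$ and $k-q$ copies of $K_p$, if $r=0$; or $q$ copies of $K_{p+1}$, $k-q-1$ copies of $K_p$, and one copy of any one graph $G\in\mathcal{F}_{p,r}$, if $0<r<p$.
   Context: For a finite graph $G$, $\mathrm{Mad}(G)=\max\{2e(H)/|V(H)| : H\subseteq G,\ |V(H)|\geq 1\}$ ($0$ if $G$ has no edges). A $k$-decomposition of $K_n$ is a partition of $E(K_n)$ into $k$ spanning subgraphs $G_1,\dots,G_k$ (edgeless ones allowed); $M(k,n)=\max\sum_{i=1}^k\mathrm{Mad}(G_i)$ over all $k$-decompositions of $K_n$. In an edge decomposition into copies of given graphs, isolated vertices are disregarded. For $p\geq 2$, $0<r<p$ and $m=\binom{p}{2}+r$, the family $\mathcal{F}_{p,r}$ is: the graphs with $m$ edges containing $K_p$ as a subgraph, if $0<r<(p-1)/2$; the graphs with $m$ edges that contain $K_p$ or have exactly $p+1$ vertices, if $r=(p-1)/2$; the graphs with $m$ edges and exactly $p+1$ vertices,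 if $r>(p-1)/2$. -}

module Defs where

open import Data.Bool using (Bool; true; false; _∧_; _∨_; not; if_then_else_; T)
open import Data.Nat as ℕ using (ℕ; zero; suc; _*_; _<ᵇ_; _≤ᵇ_)
open import Data.Fin as F using (Fin; toℕ; _≟_)
open import Data.Nat.Combinatorics using (_C_)
open import Data.Sum using (_⊎_)
open import Data.Fin.Subset using (Subset; _∈_; ∣_∣)
open import Data.Vec using (Vec; []; _∷_; tabulate)
open import Data.List using (List; []; _∷_; map; concatMap; filterᵇ; allFin; length; foldr)
open import Data.Bool.ListAction using (any; all)
open import Data.Product using (_×_; _,_; proj₁; proj₂; Σ)
open import Data.Integer using (+_)
open import Data.Rational using (ℚ; 0ℚ; _/_; _⊔_; _+_; _-_)
open import Relation.Nullary using (does; ¬_)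
open import Relation.Binary.PropositionalEquality using (_≡_)

_==_ : {n : ℕ} → Fin n → Fin n → Bool
i == j = does (i ≟ j)

-- An edge of K_n is represented by a pair (i , j) with i < j.
Edge : ℕ → Set
Edge n = Fin n × Fin n

allEdges : (n : ℕ) → List (Edge n)
allEdges n = concatMap (λ i → map (λ j → (i , j)) (filterᵇ (λ j → toℕ i <ᵇ toℕ j) (allFin n))) (allFin n)

-- A (spanning) graph on vertex set Fin n, given by its edge list (a sublist of allEdges n).
Graph : ℕ → Set
Graph n = List (Edge n)

-- A k-decomposition of K_n: each edge (i , j), i < j, receives a colour in Fin k
-- (only the values col i j with i < j matter). G_c is the spanning subgraph of colour c.
Decomposition : ℕ → ℕ → Set
Decomposition k n = Fin n → Fin n → Fin k

colourClass : {k n : ℕ} → Decomposition k n → Fin k → Graph n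
colourClass {k} {n} col c = filterᵇ (λ e → col (proj₁ e) (proj₂ e) == c) (allEdges n)

allSubsets : (n : ℕ) → List (Subset n)
allSubsets zero = [] ∷ []
allSubsets (suc n) = concatMap (λ s → (true ∷ s) ∷ (false ∷ s) ∷ []) (allSubsets n)

sublists : {A : Set} → List A → List (List A)
sublists [] = [] ∷ []
sublists (x ∷ xs) = concatMap (λ s → (x ∷ s) ∷ s ∷ []) (sublists xs)

inS : {n : ℕ} → Fin n → Subset n → Bool
inS F.zero (b ∷ s) = b
inS (F.suc i) (b ∷ s) = inS i s

-- a / d as a rational, with the convention a / 0 = 0
ratio : ℕ → ℕ → ℚ
ratio a zero = 0ℚ
ratio a (suc d) = + a / suc d

-- Maximum of a list of rationals (0 for the empty list; all our values are ≥ 0).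
maxℚ : List ℚ → ℚ
maxℚ = foldr _⊔_ 0ℚ

-- A subgraph H is a vertex set S ⊆ V(G) together with a set F ⊆ E(G) of edges
-- with both endpoints in S. Pairs with |S| = 0 contribute 0 (harmless, and gives
-- Mad(G) = 0 for edgeless G).
Mad : {n : ℕ} → Graph n → ℚ
Mad {n} G = maxℚ (concatMap (λ S → map (λ F →
                 if all (λ e → inS (proj₁ e) S ∧ inS (proj₂ e) S) F
                 then ratio (2 * length F) ∣ S ∣ else 0ℚ)
               (sublists G)) (allSubsets n))

sumMad : {k n : ℕ} → Decomposition k n → ℚ
sumMad {k} col = foldr _+_ 0ℚ (map (λ c → Mad (colourClass col c)) (allFin k))

adj : {n : ℕ} → Graph n → Fin n → Fin n → Bool
adj E i j = any (λ e → ((proj₁ e == i) ∧ (proj₂ e == j)) ∨ ((proj₁ e == j) ∧ (proj₂ e == i))) E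

touched : {n : ℕ} → Graph n → Subset n
touched E = tabulate (λ v → any (λ e → (proj₁ e == v) ∨ (proj₂ e == v)) E)

nVert : {n : ℕ} → Graph n → ℕ
nVert E = ∣ touched E ∣

IsCopyOfK : {n : ℕ} → Graph n → ℕ → Set
IsCopyOfK E s = (nVert E ≡ s) ×
  (∀ i j → i ∈ touched E → j ∈ touched E → ¬ (i ≡ j) → T (adj E i j))

ContainsK : {n : ℕ} → Graph n → ℕ → Set
ContainsK {n} E p = Σ (Subset n) λ S → (∣ S ∣ ≡ p) ×
  (∀ i j → i ∈ S → j ∈ S → ¬ (i ≡ j) → T (adj E i j))

-- E (isolated vertices disregarded) is (a copy of) a graph in F_{p,r}
InFamily : {n : ℕ} → ℕ → ℕ → Graph n → Set
InFamily p r E =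
  (length E ≡ (p C 2) ℕ.+ r) ×
  (if 2 * r ℕ.+ 1 <ᵇ p then ContainsK E p
   else if p <ᵇ 2 * r ℕ.+ 1 then nVert E ≡ suc p
   else (ContainsK E p ⊎ nVert E ≡ suc p))

partSpec : {n : ℕ} → (k p q r : ℕ) → Fin k → Graph n → Set
partSpec k p q r c E =
  if toℕ c <ᵇ q then IsCopyOfK E (suc p)
  else if r ℕ.≡ᵇ 0 then IsCopyOfK E p
  else if suc (toℕ c) <ᵇ k then IsCopyOfK E p
  else InFamily p r E

AdmitsDecomposition : (k n p q r : ℕ) → Set
AdmitsDecomposition k n p q r =
  Σ (Decomposition k n) λ col → ∀ (c : Fin k) → partSpec k p q r c (colourClass col c)

-- The upper bound of Theorem 5.2 (the two cases agree when r = (p-1)/2).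
bound : (k p q r : ℕ) → ℚ
bound k p q r =
  if 2 * r ℕ.+ 1 ≤ᵇ p
  then (+ (k * p ℕ.+ q) / 1) - (+ k / 1)
  else ((+ (k * p ℕ.+ q ℕ.+ 1) / 1) - (+ k / 1)) - (+ (2 * (p ℕ.∸ r)) / suc p)

-- Write p = P + 1 and Φ p m = (p+1)⌊m/p⌋ + max(0, 2(m mod p)+1-p).  For a graph
-- with e edges put e + C(p,2) = u·p + j with j < p, so that
-- Φ p (e + C(p,2)) = (p+1)u + max(0, 2j+1-p).  A subgraph on s vertices with
-- f ≤ min(e, C(s,2)) edges has (p+1)·2f ≤ Φ p (e + C(p,2))·s: for s ≤ u+1
-- because 2f ≤ s(s-1), for s ≥ u+3 because 2e ≤ u(u+3), and for s = u+2 by a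
-- direct computation.  Hence Mad ≤ Φ p (e + C(p,2))/(p+1) for every colour
-- class.  Φ p is superadditive and the classes have C(n,2) edges in total, so
-- the sum of the Mads is at most Φ p (C(n,2) + k·C(p,2))/(p+1) =
-- Φ p (r + (kP+q)p)/(p+1), which is the bound.  In a decomposition of the
-- prescribed shape every part attains its share of this value, through a
-- clique on p+1 or p vertices, or through all p+1 vertices of the graph from
-- F_{p,r}.
module Submission where

open import Defs
open import Data.Nat using (ℕ; _≤_; _<_; _+_; _*_; suc)
open import Data.Nat.Combinatorics using (_C_)
open import Data.Product using (_×_; Σ)
open import Data.Rational using (ℚ) renaming (_≤_ to _≤ℚ_)
open import Relation.Binary.PropositionalEquality using (_≡_)

open import Data.Bool using (Bool; true; false; T; _∧_; _∨_; if_then_else_)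
open import Data.Bool.ListAction using (all)
open import Data.Bool.Properties using (T-∧; T-∨; T-≡)
open import Data.Empty using (⊥-elim)
open import Data.Fin using (Fin; toℕ)
import Data.Fin as Fin
open import Data.Fin.Subset using (Subset; ∣_∣) renaming (_∈_ to _∈ₛ_; ⊥ to ∅)
open import Data.Fin.Subset.Properties using (∣⊥∣≡0)
import Data.Integer as ℤ
import Data.Integer.Properties as ℤ
open import Data.List using (List; []; _∷_; map; foldr; filterᵇ; allFin; length; concatMap; tabulate; _++_)
open import Data.List.Membership.Propositional using (_∈_; find)
open import Data.List.Membership.Propositional.Properties using (∈-concatMap⁺; ∈-concatMap⁻; ∈-map⁺; ∈-map⁻; ∈-filter⁻)
import Data.List.Properties as List
open import Data.List.Relation.Binary.Sublist.Propositional using (_⊆_; []; _∷_; _∷ʳ_; minimum; ⊆-refl; ⊆-trans)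
open import Data.List.Relation.Binary.Sublist.Propositional.Properties using (filter⁺; filter-⊆; length-mono-≤)
open import Data.List.Relation.Unary.All as All using (All; []; _∷_)
open import Data.List.Relation.Unary.All.Properties using (all⁺; all⁻; tabulate⁺)
open import Data.List.Relation.Unary.Any as Any using (here; there)
open import Data.List.Relation.Unary.Any.Properties using (any⁺; any⁻)
open import Data.Nat using (zero; _∸_; z≤n; s≤s; NonZero; _<ᵇ_; _≤ᵇ_; _≡ᵇ_)
open import Data.Nat.DivMod using (_/_; _%_; m%n<n; m≡m%n+[m/n]*n; [m+kn]%n≡m%n; m<n⇒m%n≡m; +-distrib-/-∣ʳ; m<n⇒m/n≡0; m*n/n≡m)
open import Data.Nat.Divisibility using (n∣m*n)
open import Data.Nat.Combinatorics using (nC1≡n; nCk+nC[k+1]≡[n+1]C[k+1])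
open import Data.Nat.ListAction using (sum)
open import Data.Nat.Properties
open import Data.Nat.Tactic.RingSolver using (solve-∀)
open import Data.Product using (_,_; proj₁; proj₂)
import Data.Product as Product
import Data.Rational as ℚ
open import Data.Rational using (0ℚ)
import Data.Rational.Properties as ℚ
open import Algebra.Properties.Group ℚ.+-0-group using (//-rightDividesʳ)
open import Data.Rational.Unnormalised as ℚᵘ using (mkℚᵘ; *≤*)
import Data.Rational.Unnormalised.Properties as ℚᵘ
open import Data.Sum using (_⊎_; inj₁; inj₂)
import Data.Sum as Sum
open import Data.Vec using ([]; _∷_; here; there)
import Data.Vec as Vec
open import Function using (_∘_; id; Equivalence)
open import Relation.Binary.Definitions using (tri<; tri≈; tri>)
open import Relation.Binary.PropositionalEquality using (refl; sym; trans; cong; cong₂; subst; subst₂; module ≡-Reasoning)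
open import Relation.Nullary using (T?; yes; no)

[1+n]C2≡n+nC2 : ∀ n → suc n C 2 ≡ n + n C 2
[1+n]C2≡n+nC2 n = trans (sym (nCk+nC[k+1]≡[n+1]C[k+1] n 1)) (cong (_+ n C 2) (nC1≡n n))

2*[1+n]C2≡[1+n]*n : ∀ n → 2 * (suc n C 2) ≡ suc n * n
2*[1+n]C2≡[1+n]*n zero    = refl
2*[1+n]C2≡[1+n]*n (suc n) = begin
  2 * (suc (suc n) C 2)        ≡⟨ cong (2 *_) ([1+n]C2≡n+nC2 (suc n)) ⟩
  2 * (suc n + suc n C 2)      ≡⟨ *-distribˡ-+ 2 (suc n) (suc n C 2) ⟩
  2 * suc n + 2 * (suc n C 2)  ≡⟨ cong (2 * suc n +_) (2*[1+n]C2≡[1+n]*n n) ⟩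
  2 * suc n + suc n * n        ≡⟨ factor n ⟩
  suc (suc n) * suc n          ∎
  where
  open ≡-Reasoning
  factor : ∀ n → 2 * suc n + suc n * n ≡ suc (suc n) * suc n
  factor = solve-∀

n≤1+m⇒2*nC2≤n*m : ∀ {n m} → n ≤ suc m → 2 * (n C 2) ≤ n * m
n≤1+m⇒2*nC2≤n*m {zero}      _         = z≤n
n≤1+m⇒2*nC2≤n*m {suc n} {m} (s≤s n≤m) = begin
  2 * (suc n C 2)  ≡⟨ 2*[1+n]C2≡[1+n]*n n ⟩
  suc n * n        ≤⟨ *-monoʳ-≤ (suc n) n≤m ⟩
  suc n * m        ∎
  where open ≤-Reasoning

-- max(0, 2j + 1 - p), through truncated subtraction.
excess : ℕ → ℕ → ℕ
excess p j = 2 * j + 1 ∸ p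

excess-cases : ∀ p j → (2 * j + 1 ≤ p × excess p j ≡ 0) ⊎ (p + excess p j ≡ 2 * j + 1)
excess-cases p j with ≤-total (2 * j + 1) p
... | inj₁ 2j+1≤p = inj₁ (2j+1≤p , m≤n⇒m∸n≡0 2j+1≤p)
... | inj₂ p≤2j+1 = inj₂ (m+[n∸m]≡n p≤2j+1)

2j+1≤p+excess : ∀ p j → 2 * j + 1 ≤ p + excess p j
2j+1≤p+excess p j = m≤n+m∸n (2 * j + 1) p

excess-above : ∀ {p j x} → p + x ≡ 2 * j + 1 → excess p j ≡ x
excess-above {p} {j} {x} eq = trans (cong (_∸ p) (sym eq)) (m+n∸m≡n p x)

excess-< : ∀ {P j} → j < suc P → excess (suc P) j < suc P
excess-< {P} {j} (s≤s j≤P) with excess-cases (suc P) j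
... | inj₁ (_ , x≡0) = subst (_< suc P) (sym x≡0) (s≤s z≤n)
... | inj₂ eq        = +-cancelˡ-< (suc P) _ _ (begin-strict
  suc P + excess (suc P) j  ≡⟨ eq ⟩
  2 * j + 1                 ≤⟨ +-monoˡ-≤ 1 (*-monoʳ-≤ 2 j≤P) ⟩
  2 * P + 1                 <⟨ ≤-reflexive (double P) ⟩
  suc P + suc P             ∎)
  where
  open ≤-Reasoning
  double : ∀ P → suc (2 * P + 1) ≡ suc P + suc P
  double = solve-∀

excess-superadditive : ∀ P a b → excess (suc P) a + excess (suc P) b ≤ excess (suc P) (a + b)
excess-superadditive P a b with excess-cases (suc P) a | excess-cases (suc P) b
... | inj₁ (_ , x≡0) | _ = begin
  excess (suc P) a + excess (suc P) b  ≡⟨ cong (_+ excess (suc P) b) x≡0 ⟩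
  excess (suc P) b                     ≤⟨ ∸-monoˡ-≤ (suc P) (+-monoˡ-≤ 1 (*-monoʳ-≤ 2 (m≤n+m b a))) ⟩
  excess (suc P) (a + b)               ∎
  where open ≤-Reasoning
... | inj₂ _ | inj₁ (_ , y≡0) = begin
  excess (suc P) a + excess (suc P) b  ≡⟨ cong (excess (suc P) a +_) y≡0 ⟩
  excess (suc P) a + 0                 ≡⟨ +-identityʳ _ ⟩
  excess (suc P) a                     ≤⟨ ∸-monoˡ-≤ (suc P) (+-monoˡ-≤ 1 (*-monoʳ-≤ 2 (m≤m+n a b))) ⟩
  excess (suc P) (a + b)               ∎
  where open ≤-Reasoning
... | inj₂ eqa | inj₂ eqb = begin
  x + y                   ≤⟨ m≤m+n (x + y) P ⟩
  x + y + P               ≡⟨ excess-above {suc P} {a + b} (+-cancelʳ-≡ 1 _ _ (begin-equality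
    suc P + (x + y + P) + 1      ≡⟨ regroup P x y ⟩
    (suc P + x) + (suc P + y)    ≡⟨ cong₂ _+_ eqa eqb ⟩
    (2 * a + 1) + (2 * b + 1)    ≡⟨ add-odd a b ⟩
    2 * (a + b) + 1 + 1          ∎)) ⟨
  excess (suc P) (a + b)  ∎
  where
  open ≤-Reasoning
  x = excess (suc P) a
  y = excess (suc P) b
  regroup : ∀ P x y → suc P + (x + y + P) + 1 ≡ (suc P + x) + (suc P + y)
  regroup = solve-∀
  add-odd : ∀ a b → (2 * a + 1) + (2 * b + 1) ≡ 2 * (a + b) + 1 + 1
  add-odd = solve-∀

excess-carry : ∀ {P a b c} → a < suc P → b < suc P → a + b ≡ suc P + c →
               excess (suc P) a + excess (suc P) b ≤ suc (suc P) + excess (suc P) c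
excess-carry {P} {a} {b} {c} a<p b<p a+b≡p+c with excess-cases (suc P) a | excess-cases (suc P) b
... | inj₁ (_ , x≡0) | _ = begin
  excess (suc P) a + excess (suc P) b  ≡⟨ cong (_+ excess (suc P) b) x≡0 ⟩
  excess (suc P) b                     ≤⟨ <⇒≤ (excess-< b<p) ⟩
  suc P                                ≤⟨ n≤1+n (suc P) ⟩
  suc (suc P)                          ≤⟨ m≤m+n (suc (suc P)) _ ⟩
  suc (suc P) + excess (suc P) c       ∎
  where open ≤-Reasoning
... | inj₂ _ | inj₁ (_ , y≡0) = begin
  excess (suc P) a + excess (suc P) b  ≡⟨ cong (excess (suc P) a +_) y≡0 ⟩
  excess (suc P) a + 0                 ≡⟨ +-identityʳ _ ⟩
  excess (suc P) a                     ≤⟨ <⇒≤ (excess-< a<p) ⟩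
  suc P                                ≤⟨ n≤1+n (suc P) ⟩
  suc (suc P)                          ≤⟨ m≤m+n (suc (suc P)) _ ⟩
  suc (suc P) + excess (suc P) c       ∎
  where open ≤-Reasoning
... | inj₂ eqa | inj₂ eqb = begin
  x + y                            ≡⟨ +-cancelˡ-≡ (suc P + suc P) _ _ (begin-equality
    (suc P + suc P) + (x + y)          ≡⟨ regroup P x y ⟩
    (suc P + x) + (suc P + y)          ≡⟨ cong₂ _+_ eqa eqb ⟩
    (2 * a + 1) + (2 * b + 1)          ≡⟨ add-odd a b ⟩
    2 * (a + b) + 2                    ≡⟨ cong (λ m → 2 * m + 2) a+b≡p+c ⟩
    2 * (suc P + c) + 2                ≡⟨ split P c ⟩
    (suc P + suc P) + suc (2 * c + 1)  ∎) ⟩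
  suc (2 * c + 1)                  ≤⟨ s≤s (2j+1≤p+excess (suc P) c) ⟩
  suc (suc P + excess (suc P) c)   ∎
  where
  open ≤-Reasoning
  x = excess (suc P) a
  y = excess (suc P) b
  regroup : ∀ P x y → (suc P + suc P) + (x + y) ≡ (suc P + x) + (suc P + y)
  regroup = solve-∀
  add-odd : ∀ a b → (2 * a + 1) + (2 * b + 1) ≡ 2 * (a + b) + 2
  add-odd = solve-∀
  split : ∀ P c → 2 * (suc P + c) + 2 ≡ (suc P + suc P) + suc (2 * c + 1)
  split = solve-∀

Φ : (p : ℕ) .{{_ : NonZero p}} → ℕ → ℕ
Φ p m = suc p * (m / p) + excess p (m % p)

Φ-spec : ∀ {P j} u → j < suc P → Φ (suc P) (j + u * suc P) ≡ suc (suc P) * u + excess (suc P) j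
Φ-spec {P} {j} u j<p = cong₂ (λ v i → suc (suc P) * v + excess (suc P) i) quotient remainder
  where
  quotient : (j + u * suc P) / suc P ≡ u
  quotient = begin
    (j + u * suc P) / suc P         ≡⟨ +-distrib-/-∣ʳ j (n∣m*n u) ⟩
    j / suc P + u * suc P / suc P   ≡⟨ cong₂ _+_ (m<n⇒m/n≡0 j<p) (m*n/n≡m u (suc P)) ⟩
    u                               ∎
    where open ≡-Reasoning
  remainder : (j + u * suc P) % suc P ≡ j
  remainder = trans ([m+kn]%n≡m%n j u (suc P)) (m<n⇒m%n≡m j<p)

digits-superadditive : ∀ P {i j} u v → i < suc P → j < suc P →
  suc (suc P) * (u + v) + (excess (suc P) i + excess (suc P) j) ≤ Φ (suc P) ((i + j) + (u + v) * suc P)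
digits-superadditive P {i} {j} u v i<p j<p with <-≤-connex (i + j) (suc P)
... | inj₁ i+j<p = begin
  suc (suc P) * (u + v) + (excess (suc P) i + excess (suc P) j)  ≤⟨ +-monoʳ-≤ _ (excess-superadditive P i j) ⟩
  suc (suc P) * (u + v) + excess (suc P) (i + j)                 ≡⟨ Φ-spec (u + v) i+j<p ⟨
  Φ (suc P) ((i + j) + (u + v) * suc P)                          ∎
  where open ≤-Reasoning
... | inj₂ p≤i+j with c , p+c≡i+j ← m≤n⇒∃[o]m+o≡n p≤i+j = begin
  suc (suc P) * (u + v) + (excess (suc P) i + excess (suc P) j)  ≤⟨ +-monoʳ-≤ _ (excess-carry i<p j<p (sym p+c≡i+j)) ⟩
  suc (suc P) * (u + v) + (suc (suc P) + excess (suc P) c)       ≡⟨ carry (suc (suc P)) (u + v) (excess (suc P) c) ⟩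
  suc (suc P) * suc (u + v) + excess (suc P) c                   ≡⟨ Φ-spec (suc (u + v)) c<p ⟨
  Φ (suc P) (c + suc (u + v) * suc P)                            ≡⟨ cong (Φ (suc P)) (trans (carry-digit (suc P) c (u + v))
                                                                      (cong (_+ (u + v) * suc P) p+c≡i+j)) ⟩
  Φ (suc P) ((i + j) + (u + v) * suc P)                          ∎
  where
  open ≤-Reasoning
  carry : ∀ q w x → q * w + (q + x) ≡ q * suc w + x
  carry = solve-∀
  carry-digit : ∀ p c w → c + suc w * p ≡ (p + c) + w * p
  carry-digit = solve-∀
  c<p : c < suc P
  c<p = +-cancelˡ-< (suc P) c (suc P) (begin-strict
    suc P + c      ≡⟨ p+c≡i+j ⟩
    i + j          <⟨ +-mono-< i<p j<p ⟩
    suc P + suc P  ∎)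

Φ-superadditive : ∀ P a b → Φ (suc P) a + Φ (suc P) b ≤ Φ (suc P) (a + b)
Φ-superadditive P a b =
  subst₂ (λ a b → Φ (suc P) a + Φ (suc P) b ≤ Φ (suc P) (a + b))
    (sym (m≡m%n+[m/n]*n a (suc P))) (sym (m≡m%n+[m/n]*n b (suc P)))
    (on-digits (a / suc P) (b / suc P) (m%n<n a (suc P)) (m%n<n b (suc P)))
  where
  regroup : ∀ q u v x y → (q * u + x) + (q * v + y) ≡ q * (u + v) + (x + y)
  regroup = solve-∀
  digits : ∀ i j u v p → (i + j) + (u + v) * p ≡ (i + u * p) + (j + v * p)
  digits = solve-∀
  on-digits : ∀ {i j} u v → i < suc P → j < suc P →
              Φ (suc P) (i + u * suc P) + Φ (suc P) (j + v * suc P) ≤ Φ (suc P) ((i + u * suc P) + (j + v * suc P))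
  on-digits {i} {j} u v i<p j<p = begin
    Φ (suc P) (i + u * suc P) + Φ (suc P) (j + v * suc P)
      ≡⟨ cong₂ _+_ (Φ-spec u i<p) (Φ-spec v j<p) ⟩
    (suc (suc P) * u + excess (suc P) i) + (suc (suc P) * v + excess (suc P) j)
      ≡⟨ regroup (suc (suc P)) u v (excess (suc P) i) (excess (suc P) j) ⟩
    suc (suc P) * (u + v) + (excess (suc P) i + excess (suc P) j)
      ≤⟨ digits-superadditive P u v i<p j<p ⟩
    Φ (suc P) ((i + j) + (u + v) * suc P)
      ≡⟨ cong (Φ (suc P)) (digits i j u v (suc P)) ⟩
    Φ (suc P) ((i + u * suc P) + (j + v * suc P)) ∎
    where open ≤-Reasoning

Φ-sum : ∀ P {A : Set} (f : A → ℕ) c xs →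
        sum (map (λ x → Φ (suc P) (f x + c)) xs) ≤ Φ (suc P) (sum (map f xs) + length xs * c)
Φ-sum P f c []       = z≤n
Φ-sum P f c (x ∷ xs) = begin
  Φ (suc P) (f x + c) + sum (map (λ x → Φ (suc P) (f x + c)) xs)
    ≤⟨ +-monoʳ-≤ (Φ (suc P) (f x + c)) (Φ-sum P f c xs) ⟩
  Φ (suc P) (f x + c) + Φ (suc P) (sum (map f xs) + length xs * c)
    ≤⟨ Φ-superadditive P (f x + c) _ ⟩
  Φ (suc P) ((f x + c) + (sum (map f xs) + length xs * c))
    ≡⟨ cong (Φ (suc P)) (regroup (f x) c (sum (map f xs)) (length xs)) ⟩
  Φ (suc P) ((f x + sum (map f xs)) + suc (length xs) * c) ∎
  where
  open ≤-Reasoning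
  regroup : ∀ a c s l → (a + c) + (s + l * c) ≡ (a + s) + suc l * c
  regroup = solve-∀

-- The two sides differ by (u - P)(u - P + 1), a product of consecutive integers.
pronic-gap : ∀ P u → 2 * P + 2 * u * suc P ≤ u * (3 + u) + suc P * P
pronic-gap P u with ≤-<-connex P u
... | inj₁ P≤u with d , refl ← m≤n⇒∃[o]m+o≡n P≤u = ≤-trans (m≤m+n _ (d * suc d)) (≤-reflexive (above P d))
  where
  above : ∀ P d → 2 * P + 2 * (P + d) * suc P + d * suc d ≡ (P + d) * (3 + (P + d)) + suc P * P
  above = solve-∀
... | inj₂ u<P with d , refl ← m≤n⇒∃[o]m+o≡n u<P = ≤-trans (m≤m+n _ (suc d * d)) (≤-reflexive (below u d))
  where
  below : ∀ u d → 2 * (suc u + d) + 2 * u * suc (suc u + d) + suc d * d ≡ u * (3 + u) + suc (suc u + d) * (suc u + d)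
  below = solve-∀

-- The right side exceeds the left by (u - P)((P + 2)(u - P) + x), which is
-- nonnegative also for u < P because x ≤ P + 1.
critical-gap : ∀ P u x → x ≤ suc P →
  (suc P + x + 2 * u * suc P) * suc (suc P) ≤ (suc (suc P) * u + x) * (2 + u) + (suc P * P + 1) * suc (suc P)
critical-gap P u x x≤p with ≤-<-connex P u
... | inj₁ P≤u with d , refl ← m≤n⇒∃[o]m+o≡n P≤u =
  ≤-trans (m≤m+n _ (suc (suc P) * d * d + x * d)) (≤-reflexive (above P d x))
  where
  above : ∀ P d x → (suc P + x + 2 * (P + d) * suc P) * suc (suc P) + (suc (suc P) * d * d + x * d)
                  ≡ (suc (suc P) * (P + d) + x) * (2 + (P + d)) + (suc P * P + 1) * suc (suc P)
  above = solve-∀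
... | inj₂ u<P with d , refl ← m≤n⇒∃[o]m+o≡n u<P =
  +-cancelʳ-≤ (suc (suc P) * suc d * suc d) _ _ (begin
    LHS + suc (suc P) * suc d * suc d  ≡⟨ below u d x ⟨
    RHS + x * suc d                    ≤⟨ +-monoʳ-≤ RHS (*-monoˡ-≤ (suc d) (m≤n⇒m≤1+n x≤p)) ⟩
    RHS + suc (suc P) * suc d          ≤⟨ +-monoʳ-≤ RHS (m≤m*n (suc (suc P) * suc d) (suc d)) ⟩
    RHS + suc (suc P) * suc d * suc d  ∎)
  where
  open ≤-Reasoning
  LHS = (suc P + x + 2 * u * suc P) * suc (suc P)
  RHS = (suc (suc P) * u + x) * (2 + u) + (suc P * P + 1) * suc (suc P)
  below : ∀ u d x → (suc (suc (suc u + d)) * u + x) * (2 + u) + (suc (suc u + d) * (suc u + d) + 1) * suc (suc (suc u + d)) + x * suc d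
                  ≡ (suc (suc u + d) + x + 2 * u * suc (suc u + d)) * suc (suc (suc u + d)) + suc (suc (suc u + d)) * suc d * suc d
  below = solve-∀

edge-identity-doubled : ∀ P {e u j} → e + suc P C 2 ≡ j + u * suc P → 2 * e + suc P * P ≡ 2 * j + 2 * u * suc P
edge-identity-doubled P {e} {u} {j} eq = begin
  2 * e + suc P * P        ≡⟨ cong (2 * e +_) (2*[1+n]C2≡[1+n]*n P) ⟨
  2 * e + 2 * (suc P C 2)  ≡⟨ *-distribˡ-+ 2 e (suc P C 2) ⟨
  2 * (e + suc P C 2)      ≡⟨ cong (2 *_) eq ⟩
  2 * (j + u * suc P)      ≡⟨ distribute j u (suc P) ⟩
  2 * j + 2 * u * suc P    ∎
  where
  open ≡-Reasoning
  distribute : ∀ j u p → 2 * (j + u * p) ≡ 2 * j + 2 * u * p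
  distribute = solve-∀

2*e≤u*[3+u] : ∀ P {e u j} → j < suc P → 2 * e + suc P * P ≡ 2 * j + 2 * u * suc P → 2 * e ≤ u * (3 + u)
2*e≤u*[3+u] P {e} {u} {j} (s≤s j≤P) eq = +-cancelʳ-≤ (suc P * P) _ _ (begin
  2 * e + suc P * P        ≡⟨ eq ⟩
  2 * j + 2 * u * suc P    ≤⟨ +-monoˡ-≤ (2 * u * suc P) (*-monoʳ-≤ 2 j≤P) ⟩
  2 * P + 2 * u * suc P    ≤⟨ pronic-gap P u ⟩
  u * (3 + u) + suc P * P  ∎)
  where open ≤-Reasoning

density-at-2+u : ∀ P {e u j} → j < suc P → 2 * e + suc P * P ≡ 2 * j + 2 * u * suc P →
                 2 * e * suc (suc P) ≤ (suc (suc P) * u + excess (suc P) j) * (2 + u)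
density-at-2+u P {e} {u} {j} j<p eq = +-cancelʳ-≤ ((suc P * P + 1) * suc (suc P)) _ _ (begin
  2 * e * suc (suc P) + (suc P * P + 1) * suc (suc P)
    ≡⟨ *-distribʳ-+ (suc (suc P)) (2 * e) (suc P * P + 1) ⟨
  (2 * e + (suc P * P + 1)) * suc (suc P)
    ≤⟨ *-monoˡ-≤ (suc (suc P)) numerator ⟩
  (suc P + excess (suc P) j + 2 * u * suc P) * suc (suc P)
    ≤⟨ critical-gap P u (excess (suc P) j) (<⇒≤ (excess-< j<p)) ⟩
  (suc (suc P) * u + excess (suc P) j) * (2 + u) + (suc P * P + 1) * suc (suc P) ∎)
  where
  open ≤-Reasoning
  swap-last : ∀ a b c → a + b + c ≡ a + c + b
  swap-last = solve-∀
  numerator : 2 * e + (suc P * P + 1) ≤ suc P + excess (suc P) j + 2 * u * suc P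
  numerator = begin
    2 * e + (suc P * P + 1)                   ≡⟨ +-assoc (2 * e) (suc P * P) 1 ⟨
    2 * e + suc P * P + 1                     ≡⟨ cong (_+ 1) eq ⟩
    2 * j + 2 * u * suc P + 1                 ≡⟨ swap-last (2 * j) (2 * u * suc P) 1 ⟩
    2 * j + 1 + 2 * u * suc P                 ≤⟨ +-monoˡ-≤ (2 * u * suc P) (2j+1≤p+excess (suc P) j) ⟩
    suc P + excess (suc P) j + 2 * u * suc P  ∎

m≤u*s⇒m*q≤[q*u+x]*s : ∀ {m} q u s x → m ≤ u * s → m * q ≤ (q * u + x) * s
m≤u*s⇒m*q≤[q*u+x]*s {m} q u s x m≤us = begin
  m * q              ≤⟨ *-monoˡ-≤ q m≤us ⟩
  u * s * q          ≤⟨ m≤m+n (u * s * q) (x * s) ⟩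
  u * s * q + x * s  ≡⟨ regroup q u s x ⟩
  (q * u + x) * s    ∎
  where
  open ≤-Reasoning
  regroup : ∀ q u s x → u * s * q + x * s ≡ (q * u + x) * s
  regroup = solve-∀

density-bound : ∀ P {e f s u j} → j < suc P → e + suc P C 2 ≡ j + u * suc P → f ≤ e → f ≤ s C 2 →
                2 * f * suc (suc P) ≤ (suc (suc P) * u + excess (suc P) j) * s
density-bound P {e} {f} {s} {u} {j} j<p eq f≤e f≤sC2 with <-cmp s (2 + u)
... | tri< s<2+u _ _ = m≤u*s⇒m*q≤[q*u+x]*s (suc (suc P)) u s (excess (suc P) j) (begin
  2 * f        ≤⟨ *-monoʳ-≤ 2 f≤sC2 ⟩
  2 * (s C 2)  ≤⟨ n≤1+m⇒2*nC2≤n*m (≤-pred s<2+u) ⟩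
  s * u        ≡⟨ *-comm s u ⟩
  u * s        ∎)
  where open ≤-Reasoning
... | tri≈ _ refl _ = begin
  2 * f * suc (suc P)  ≤⟨ *-monoˡ-≤ (suc (suc P)) (*-monoʳ-≤ 2 f≤e) ⟩
  2 * e * suc (suc P)  ≤⟨ density-at-2+u P {e} {u} {j} j<p (edge-identity-doubled P {e} {u} {j} eq) ⟩
  (suc (suc P) * u + excess (suc P) j) * (2 + u) ∎
  where open ≤-Reasoning
... | tri> _ _ 2+u<s = m≤u*s⇒m*q≤[q*u+x]*s (suc (suc P)) u s (excess (suc P) j) (begin
  2 * f        ≤⟨ *-monoʳ-≤ 2 f≤e ⟩
  2 * e        ≤⟨ 2*e≤u*[3+u] P {e} {u} {j} j<p (edge-identity-doubled P {e} {u} {j} eq) ⟩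
  u * (3 + u)  ≤⟨ *-monoʳ-≤ u 2+u<s ⟩
  u * s        ∎)
  where open ≤-Reasoning

Φ-density : ∀ P {e f s} → f ≤ e → f ≤ s C 2 → 2 * f * suc (suc P) ≤ Φ (suc P) (e + suc P C 2) * s
Φ-density P {e} f≤e f≤sC2 =
  density-bound P {u = (e + suc P C 2) / suc P}
    (m%n<n (e + suc P C 2) (suc P)) (m≡m%n+[m/n]*n (e + suc P C 2) (suc P)) f≤e f≤sC2

ratio-≤ : ∀ a s c d → a * suc d ≤ c * s → ratio a s ≤ℚ ratio c (suc d)
ratio-≤ a zero    c d _  = ratio-≤ 0 1 c d z≤n
ratio-≤ a (suc b) c d le = ℚ.toℚᵘ-cancel-≤
  (ℚᵘ.≤-respʳ-≃ (ℚᵘ.≃-sym (ℚ.toℚᵘ-fromℚᵘ (mkℚᵘ (ℤ.+ c) d)))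
    (ℚᵘ.≤-respˡ-≃ (ℚᵘ.≃-sym (ℚ.toℚᵘ-fromℚᵘ (mkℚᵘ (ℤ.+ a) b)))
      (*≤* (subst₂ ℤ._≤_ (ℤ.pos-* a (suc d)) (ℤ.pos-* c (suc b)) (ℤ.+≤+ le)))))

ratio-≡ : ∀ a b c d → a * suc d ≡ c * suc b → ratio a (suc b) ≡ ratio c (suc d)
ratio-≡ a b c d eq = ℚ.≤-antisym (ratio-≤ a (suc b) c d (≤-reflexive eq)) (ratio-≤ c (suc d) a b (≤-reflexive (sym eq)))

ratio-mono-≤ : ∀ {a c} b → a ≤ c → ratio a (suc b) ≤ℚ ratio c (suc b)
ratio-mono-≤ {a} {c} b a≤c = ratio-≤ a (suc b) c b (*-monoˡ-≤ (suc b) a≤c)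

ratio-+ : ∀ a c b → ratio a (suc b) ℚ.+ ratio c (suc b) ≡ ratio (a + c) (suc b)
ratio-+ a c b = ℚ.toℚᵘ-injective (begin
  ℚ.toℚᵘ (ratio a (suc b) ℚ.+ ratio c (suc b))
    ≈⟨ ℚ.toℚᵘ-homo-+ (ratio a (suc b)) (ratio c (suc b)) ⟩
  ℚ.toℚᵘ (ratio a (suc b)) ℚᵘ.+ ℚ.toℚᵘ (ratio c (suc b))
    ≈⟨ ℚᵘ.+-cong (ℚ.toℚᵘ-fromℚᵘ (mkℚᵘ (ℤ.+ a) b)) (ℚ.toℚᵘ-fromℚᵘ (mkℚᵘ (ℤ.+ c) b)) ⟩
  mkℚᵘ (ℤ.+ a) b ℚᵘ.+ mkℚᵘ (ℤ.+ c) b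
    ≈⟨ ℚᵘ.≃-reflexive (ℚᵘ./-cong (sym (ℤ.*-distribʳ-+ (ℤ.+ suc b) (ℤ.+ a) (ℤ.+ c))) refl) ⟩
  ((ℤ.+ a ℤ.+ ℤ.+ c) ℤ.* ℤ.+ suc b) ℚᵘ./ (suc b * suc b)
    ≈⟨ ℚᵘ.*-cancelʳ-/ (suc b) ⟩
  mkℚᵘ (ℤ.+ (a + c)) b
    ≈⟨ ℚ.toℚᵘ-fromℚᵘ (mkℚᵘ (ℤ.+ (a + c)) b) ⟨
  ℚ.toℚᵘ (ratio (a + c) (suc b)) ∎)
  where open ℚᵘ.≃-Reasoning

ratio-+-cancelʳ : ∀ a c b → ratio (a + c) (suc b) ℚ.- ratio c (suc b) ≡ ratio a (suc b)
ratio-+-cancelʳ a c b = trans (cong (ℚ._- ratio c (suc b)) (sym (ratio-+ a c b)))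
                              (//-rightDividesʳ (ratio c (suc b)) (ratio a (suc b)))

sumℚ-mono-≤ : ∀ {A : Set} {f g : A → ℚ} xs → (∀ x → f x ≤ℚ g x) → foldr ℚ._+_ 0ℚ (map f xs) ≤ℚ foldr ℚ._+_ 0ℚ (map g xs)
sumℚ-mono-≤ []       f≤g = ℚ.≤-refl
sumℚ-mono-≤ (x ∷ xs) f≤g = ℚ.+-mono-≤ (f≤g x) (sumℚ-mono-≤ xs f≤g)

sumℚ-ratio : ∀ {A : Set} (h : A → ℕ) b xs → foldr ℚ._+_ 0ℚ (map (λ x → ratio (h x) (suc b)) xs) ≡ ratio (sum (map h xs)) (suc b)
sumℚ-ratio h b []       = ratio-≡ 0 0 0 b refl
sumℚ-ratio h b (x ∷ xs) = trans (cong (ratio (h x) (suc b) ℚ.+_) (sumℚ-ratio h b xs)) (ratio-+ (h x) (sum (map h xs)) b)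

inside : ∀ {n} → Subset n → Edge n → Bool
inside S e = inS (proj₁ e) S ∧ inS (proj₂ e) S

completeOn : ∀ {n} → Subset n → Graph n
completeOn {n} S = filterᵇ (inside S) (allEdges n)

⊆-filterᵇ : ∀ {A : Set} (p : A → Bool) {xs ys} → xs ⊆ ys → All (T ∘ p) xs → xs ⊆ filterᵇ p ys
⊆-filterᵇ p {xs} {ys} xs⊆ys pxs =
  subst (_⊆ filterᵇ p ys) (List.filter-all (T? ∘ p) pxs) (filter⁺ (T? ∘ p) (T? ∘ p) (λ { refl px → px }) xs⊆ys)

filterᵇ-map : ∀ {A B : Set} (p : B → Bool) (f : A → B) xs → filterᵇ p (map f xs) ≡ map f (filterᵇ (p ∘ f) xs)
filterᵇ-map p f []       = refl
filterᵇ-map p f (x ∷ xs) with p (f x)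
... | true  = cong (f x ∷_) (filterᵇ-map p f xs)
... | false = filterᵇ-map p f xs

∈-sublists : ∀ {A : Set} {xs ys : List A} → xs ⊆ ys → xs ∈ sublists ys
∈-sublists []             = here refl
∈-sublists (y ∷ʳ xs⊆ys)   = ∈-concatMap⁺ _ (Any.map (λ { refl → there (here refl) }) (∈-sublists xs⊆ys))
∈-sublists (refl ∷ xs⊆ys) = ∈-concatMap⁺ _ (Any.map (λ { refl → here refl }) (∈-sublists xs⊆ys))

sublists-⊆ : ∀ {A : Set} {xs : List A} ys → xs ∈ sublists ys → xs ⊆ ys
sublists-⊆ []       (here refl) = []
sublists-⊆ (y ∷ ys) xs∈ with find (∈-concatMap⁻ (λ s → (y ∷ s) ∷ s ∷ []) {xs = sublists ys} xs∈)
... | zs , zs∈ , here refl         = refl ∷ sublists-⊆ ys zs∈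
... | zs , zs∈ , there (here refl) = y ∷ʳ sublists-⊆ ys zs∈

∈-allSubsets : ∀ {n} (S : Subset n) → S ∈ allSubsets n
∈-allSubsets []          = here refl
∈-allSubsets (true ∷ S)  = ∈-concatMap⁺ _ (Any.map (λ { refl → here refl }) (∈-allSubsets S))
∈-allSubsets (false ∷ S) = ∈-concatMap⁺ _ (Any.map (λ { refl → there (here refl) }) (∈-allSubsets S))

≤-maxℚ : ∀ {x xs} → x ∈ xs → x ≤ℚ maxℚ xs
≤-maxℚ {xs = x ∷ xs} (here refl)  = ℚ.p≤p⊔q x (maxℚ xs)
≤-maxℚ {xs = y ∷ xs} (there x∈xs) = ℚ.≤-trans (≤-maxℚ x∈xs) (ℚ.p≤q⊔p y (maxℚ xs))

maxℚ-lub : ∀ {y} xs → 0ℚ ≤ℚ y → (∀ {x} → x ∈ xs → x ≤ℚ y) → maxℚ xs ≤ℚ y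
maxℚ-lub []       0≤y _   = 0≤y
maxℚ-lub (x ∷ xs) 0≤y xs≤ = ℚ.⊔-lub (xs≤ (here refl)) (maxℚ-lub xs 0≤y (xs≤ ∘ there))

module _ {n : ℕ} (G : Graph n) where

  private
    value : Subset n → Graph n → ℚ
    value S F = if all (inside S) F then ratio (2 * length F) ∣ S ∣ else 0ℚ

    values : List ℚ
    values = concatMap (λ S → map (value S) (sublists G)) (allSubsets n)

  subgraph-density≤Mad : ∀ S F → F ⊆ G → All (T ∘ inside S) F → ratio (2 * length F) ∣ S ∣ ≤ℚ Mad G
  subgraph-density≤Mad S F F⊆G inside-S =
    subst (λ b → (if b then ratio (2 * length F) ∣ S ∣ else 0ℚ) ≤ℚ Mad G)
      (Equivalence.to T-≡ (all⁻ (inside S) inside-S))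
      (≤-maxℚ (∈-concatMap⁺ _ (Any.map (λ { refl → ∈-map⁺ (value S) (∈-sublists F⊆G) }) (∈-allSubsets S))))

  Mad-lub : ∀ {y} → (∀ S F → F ⊆ G → All (T ∘ inside S) F → ratio (2 * length F) ∣ S ∣ ≤ℚ y) → Mad G ≤ℚ y
  Mad-lub {y} density≤y = maxℚ-lub values 0≤y value≤y
    where
    0≤y : 0ℚ ≤ℚ y
    0≤y = subst (λ s → ratio 0 s ≤ℚ y) (∣⊥∣≡0 n) (density≤y ∅ [] (minimum G) [])
    value≤y : ∀ {x} → x ∈ values → x ≤ℚ y
    value≤y x∈ with find (∈-concatMap⁻ _ {xs = allSubsets n} x∈)
    ... | S , _ , x∈S-values with ∈-map⁻ (value S) x∈S-values
    ...   | F , F∈ , refl with all (inside S) F in inside-S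
    ...     | true  = density≤y S F (sublists-⊆ G F∈) (all⁺ (inside S) F (Equivalence.from T-≡ inside-S))
    ...     | false = 0≤y

allEdges-suc : ∀ n → allEdges (suc n) ≡ map (λ j → Fin.zero , Fin.suc j) (allFin n) ++ map (Product.map Fin.suc Fin.suc) (allEdges n)
allEdges-suc n = cong₂ _++_ first-row later-rows
  where
  row : ∀ {m} → Fin m → Graph m
  row {m} i = map (i ,_) (filterᵇ (λ j → toℕ i <ᵇ toℕ j) (allFin m))
  first-row : row {suc n} Fin.zero ≡ map (λ j → Fin.zero , Fin.suc j) (allFin n)
  first-row = begin
    map (Fin.zero ,_) (filterᵇ (λ j → 0 <ᵇ toℕ j) (tabulate Fin.suc))
      ≡⟨ cong (map (Fin.zero ,_)) (List.filter-all (T? ∘ _) (tabulate⁺ (λ _ → _))) ⟩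
    map (Fin.zero ,_) (tabulate Fin.suc)          ≡⟨ List.map-tabulate Fin.suc (Fin.zero ,_) ⟩
    tabulate (λ j → Fin.zero , Fin.suc j)         ≡⟨ List.map-tabulate id (λ j → Fin.zero , Fin.suc j) ⟨
    map (λ j → Fin.zero , Fin.suc j) (allFin n)   ∎
    where open ≡-Reasoning
  shifted-row : ∀ i → row (Fin.suc i) ≡ map (Product.map Fin.suc Fin.suc) (row i)
  shifted-row i = begin
    map (Fin.suc i ,_) (filterᵇ (λ j → suc (toℕ i) <ᵇ toℕ j) (tabulate Fin.suc))
      ≡⟨ cong (map (Fin.suc i ,_) ∘ filterᵇ _) (List.map-tabulate id Fin.suc) ⟨
    map (Fin.suc i ,_) (filterᵇ (λ j → suc (toℕ i) <ᵇ toℕ j) (map Fin.suc (allFin n)))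
      ≡⟨ cong (map (Fin.suc i ,_)) (filterᵇ-map _ Fin.suc (allFin n)) ⟩
    map (Fin.suc i ,_) (map Fin.suc (filterᵇ (λ j → toℕ i <ᵇ toℕ j) (allFin n)))
      ≡⟨ List.map-∘ _ ⟨
    map (λ j → Fin.suc i , Fin.suc j) (filterᵇ (λ j → toℕ i <ᵇ toℕ j) (allFin n))
      ≡⟨ List.map-∘ _ ⟩
    map (Product.map Fin.suc Fin.suc) (row i) ∎
    where open ≡-Reasoning
  later-rows : concatMap row (tabulate Fin.suc) ≡ map (Product.map Fin.suc Fin.suc) (allEdges n)
  later-rows = begin
    concatMap row (tabulate Fin.suc)                               ≡⟨ cong (concatMap row) (List.map-tabulate id Fin.suc) ⟨
    concatMap row (map Fin.suc (allFin n))                         ≡⟨ List.concatMap-map row Fin.suc (allFin n) ⟩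
    concatMap (row ∘ Fin.suc) (allFin n)                           ≡⟨ List.concatMap-cong shifted-row (allFin n) ⟩
    concatMap (map (Product.map Fin.suc Fin.suc) ∘ row) (allFin n) ≡⟨ List.map-concatMap (Product.map Fin.suc Fin.suc) row (allFin n) ⟨
    map (Product.map Fin.suc Fin.suc) (allEdges n)                 ∎
    where open ≡-Reasoning

length-members : ∀ {n} (S : Subset n) → length (filterᵇ (λ i → inS i S) (allFin n)) ≡ ∣ S ∣
length-members []              = refl
length-members {suc n} (b ∷ S) = begin
  length (filterᵇ (λ i → inS i (b ∷ S)) (Fin.zero ∷ tabulate Fin.suc))
    ≡⟨ cong (λ is → length (filterᵇ (λ i → inS i (b ∷ S)) (Fin.zero ∷ is))) (List.map-tabulate id Fin.suc) ⟨
  length (filterᵇ (λ i → inS i (b ∷ S)) (Fin.zero ∷ map Fin.suc (allFin n)))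
    ≡⟨ head-and-tail b ⟩
  ∣ b ∷ S ∣ ∎
  where
  open ≡-Reasoning
  tail-count : ∀ b → length (filterᵇ (λ i → inS i (b ∷ S)) (map Fin.suc (allFin n))) ≡ ∣ S ∣
  tail-count b = trans (cong length (filterᵇ-map _ Fin.suc (allFin n)))
                       (trans (List.length-map Fin.suc (filterᵇ (λ i → inS i S) (allFin n))) (length-members S))
  head-and-tail : ∀ b → length (filterᵇ (λ i → inS i (b ∷ S)) (Fin.zero ∷ map Fin.suc (allFin n))) ≡ ∣ b ∷ S ∣
  head-and-tail true  = cong suc (tail-count true)
  head-and-tail false = tail-count false

length-completeOn : ∀ {n} (S : Subset n) → length (completeOn S) ≡ ∣ S ∣ C 2
length-completeOn []              = refl
length-completeOn {suc n} (b ∷ S) = begin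
  length (filterᵇ (inside (b ∷ S)) (allEdges (suc n)))
    ≡⟨ cong (length ∘ filterᵇ (inside (b ∷ S))) (allEdges-suc n) ⟩
  length (filterᵇ (inside (b ∷ S)) (map spoke (allFin n) ++ map shift (allEdges n)))
    ≡⟨ cong length (List.filter-++ (T? ∘ inside (b ∷ S)) (map spoke (allFin n)) _) ⟩
  length (filterᵇ (inside (b ∷ S)) (map spoke (allFin n)) ++ filterᵇ (inside (b ∷ S)) (map shift (allEdges n)))
    ≡⟨ List.length-++ (filterᵇ (inside (b ∷ S)) (map spoke (allFin n))) ⟩
  length (filterᵇ (inside (b ∷ S)) (map spoke (allFin n))) + length (filterᵇ (inside (b ∷ S)) (map shift (allEdges n)))
    ≡⟨ cong₂ _+_ (spokes b) shifted ⟩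
  (if b then ∣ S ∣ else 0) + ∣ S ∣ C 2
    ≡⟨ add-vertex b ⟩
  ∣ b ∷ S ∣ C 2 ∎
  where
  open ≡-Reasoning
  spoke : Fin n → Edge (suc n)
  spoke j = Fin.zero , Fin.suc j
  shift : Edge n → Edge (suc n)
  shift = Product.map Fin.suc Fin.suc
  members : ∀ b → length (filterᵇ (λ j → b ∧ inS j S) (allFin n)) ≡ (if b then ∣ S ∣ else 0)
  members true  = length-members S
  members false = cong length (List.filter-none (T? ∘ (λ _ → false)) (All.universal (λ _ ()) (allFin n)))
  spokes : ∀ b → length (filterᵇ (inside (b ∷ S)) (map spoke (allFin n))) ≡ (if b then ∣ S ∣ else 0)
  spokes b = trans (cong length (filterᵇ-map (inside (b ∷ S)) spoke (allFin n)))
                   (trans (List.length-map spoke (filterᵇ (λ j → b ∧ inS j S) (allFin n))) (members b))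
  shifted : length (filterᵇ (inside (b ∷ S)) (map shift (allEdges n))) ≡ ∣ S ∣ C 2
  shifted = trans (cong length (filterᵇ-map (inside (b ∷ S)) shift (allEdges n)))
                  (trans (List.length-map shift (completeOn S)) (length-completeOn S))
  add-vertex : ∀ b → (if b then ∣ S ∣ else 0) + ∣ S ∣ C 2 ≡ ∣ b ∷ S ∣ C 2
  add-vertex true  = sym ([1+n]C2≡n+nC2 ∣ S ∣)
  add-vertex false = refl

length-allEdges : ∀ n → length (allEdges n) ≡ n C 2
length-allEdges zero    = refl
length-allEdges (suc n) = begin
  length (allEdges (suc n))
    ≡⟨ cong length (allEdges-suc n) ⟩
  length (map (λ j → Fin.zero , Fin.suc j) (allFin n) ++ map (Product.map Fin.suc Fin.suc) (allEdges n))
    ≡⟨ List.length-++ (map (λ j → Fin.zero , Fin.suc j) (allFin n)) ⟩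
  length (map (λ j → Fin.zero , Fin.suc j) (allFin n)) + length (map (Product.map Fin.suc Fin.suc) (allEdges n))
    ≡⟨ cong₂ _+_ (trans (List.length-map _ (allFin n)) (List.length-tabulate id))
                 (trans (List.length-map _ (allEdges n)) (length-allEdges n)) ⟩
  n + n C 2
    ≡⟨ [1+n]C2≡n+nC2 n ⟨
  suc n C 2 ∎
  where open ≡-Reasoning

length-subgraph : ∀ {n} {F : Graph n} S → F ⊆ allEdges n → All (T ∘ inside S) F → length F ≤ ∣ S ∣ C 2
length-subgraph S F⊆ inside-S =
  subst (_ ≤_) (length-completeOn S) (length-mono-≤ (⊆-filterᵇ (inside S) F⊆ inside-S))

∈allEdges⇒< : ∀ {n e} → e ∈ allEdges n → toℕ (proj₁ e) < toℕ (proj₂ e)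
∈allEdges⇒< {n} e∈ with find (∈-concatMap⁻ _ {xs = allFin n} e∈)
... | i , _ , e∈row with ∈-map⁻ (i ,_) e∈row
...   | j , j∈ , refl = <ᵇ⇒< (toℕ i) (toℕ j) (proj₂ (∈-filter⁻ (T? ∘ (λ j → toℕ i <ᵇ toℕ j)) {xs = allFin n} j∈))

inS⇒∈ : ∀ {n} {i : Fin n} {S} → T (inS i S) → i ∈ₛ S
inS⇒∈ {i = Fin.zero}  {true ∷ S} _ = here
inS⇒∈ {i = Fin.suc i} {b ∷ S}    t = there (inS⇒∈ t)

inS-tabulate : ∀ {n} (f : Fin n → Bool) i → inS i (Vec.tabulate f) ≡ f i
inS-tabulate f Fin.zero    = refl
inS-tabulate f (Fin.suc i) = inS-tabulate (f ∘ Fin.suc) i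

==⇒≡ : ∀ {n} {i j : Fin n} → T (i == j) → i ≡ j
==⇒≡ {i = i} {j} t with i Fin.≟ j
... | yes i≡j = i≡j

≡⇒== : ∀ {n} {i j : Fin n} → i ≡ j → T (i == j)
≡⇒== {i = i} {j} i≡j with i Fin.≟ j
... | yes _  = _
... | no i≢j = i≢j i≡j

edge-ends : ∀ {n} {e : Edge n} {a b} → T ((proj₁ e == a) ∧ (proj₂ e == b)) → e ≡ (a , b)
edge-ends t = let t₁ , t₂ = Equivalence.to T-∧ t in cong₂ _,_ (==⇒≡ t₁) (==⇒≡ t₂)

adj⇒∈ : ∀ {n} {G : Graph n} {i j} → T (adj G i j) → (i , j) ∈ G ⊎ (j , i) ∈ G
adj⇒∈ {G = G} ij =
  let e , e∈G , ends = find (any⁻ _ G ij)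
  in Sum.map (λ t → subst (_∈ G) (edge-ends t) e∈G) (λ t → subst (_∈ G) (edge-ends t) e∈G) (Equivalence.to T-∨ ends)

clique-density≤Mad : ∀ {n} (P : Edge n → Bool) {s} → ContainsK (filterᵇ P (allEdges n)) s →
                     ratio (2 * (s C 2)) s ≤ℚ Mad (filterᵇ P (allEdges n))
clique-density≤Mad {n} P (S , refl , clique) =
  subst (λ m → ratio (2 * m) ∣ S ∣ ≤ℚ Mad (filterᵇ P (allEdges n))) (length-completeOn S)
    (subgraph-density≤Mad _ S (completeOn S) (⊆-filterᵇ P (filter-⊆ (T? ∘ inside S) (allEdges n)) coloured)
      (All.tabulate (λ e∈ → proj₂ (∈-filter⁻ (T? ∘ inside S) {xs = allEdges n} e∈))))
  where
  edge-coloured : ∀ {e} → e ∈ allEdges n × T (inside S e) → T (P e)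
  edge-coloured {e} (e∈A , in-S) with Equivalence.to T-∧ in-S
  ... | i∈S , j∈S with adj⇒∈ (clique (proj₁ e) (proj₂ e) (inS⇒∈ i∈S) (inS⇒∈ j∈S) (λ i≡j → <-irrefl (cong toℕ i≡j) (∈allEdges⇒< e∈A)))
  ...   | inj₁ e∈G  = proj₂ (∈-filter⁻ (T? ∘ P) {xs = allEdges n} e∈G)
  ...   | inj₂ e′∈G = ⊥-elim (<-asym (∈allEdges⇒< e∈A) (∈allEdges⇒< (proj₁ (∈-filter⁻ (T? ∘ P) {xs = allEdges n} e′∈G))))
  coloured : All (T ∘ P) (completeOn S)
  coloured = All.tabulate (λ e∈K → edge-coloured (∈-filter⁻ (T? ∘ inside S) {xs = allEdges n} e∈K))

incident : ∀ {n} (e : Edge n) v → (proj₁ e ≡ v) ⊎ (proj₂ e ≡ v) → T ((proj₁ e == v) ∨ (proj₂ e == v))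
incident e v = Equivalence.from (T-∨ {proj₁ e == v} {proj₂ e == v}) ∘ Sum.map ≡⇒== ≡⇒==

touched-density≤Mad : ∀ {n} (G : Graph n) → ratio (2 * length G) (nVert G) ≤ℚ Mad G
touched-density≤Mad G = subgraph-density≤Mad G (touched G) G ⊆-refl (All.tabulate endpoints-touched)
  where
  touching : ∀ {e} → e ∈ G → ∀ v → (proj₁ e ≡ v) ⊎ (proj₂ e ≡ v) → T (inS v (touched G))
  touching {e} e∈G v ends = subst T (sym (inS-tabulate _ v))
    (any⁺ (λ e′ → (proj₁ e′ == v) ∨ (proj₂ e′ == v)) (Any.map (λ { refl → incident e v ends }) e∈G))
  endpoints-touched : ∀ {e} → e ∈ G → T (inside (touched G) e)
  endpoints-touched {e} e∈G = Equivalence.from (T-∧ {inS (proj₁ e) (touched G)} {inS (proj₂ e) (touched G)})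
    (touching e∈G (proj₁ e) (inj₁ refl) , touching e∈G (proj₂ e) (inj₂ refl))

sum-allFin-suc : ∀ {k} (f : Fin (suc k) → ℕ) → sum (map f (allFin (suc k))) ≡ f Fin.zero + sum (map (f ∘ Fin.suc) (allFin k))
sum-allFin-suc f = cong (λ xs → f Fin.zero + sum xs) (trans (List.map-tabulate Fin.suc f) (sym (List.map-tabulate id (f ∘ Fin.suc))))

sum-zeros : ∀ {A : Set} (xs : List A) → sum (map (λ _ → 0) xs) ≡ 0
sum-zeros []       = refl
sum-zeros (_ ∷ xs) = sum-zeros xs

sum-map-+ : ∀ {A : Set} (f g : A → ℕ) xs → sum (map (λ x → f x + g x) xs) ≡ sum (map f xs) + sum (map g xs)
sum-map-+ f g []       = refl
sum-map-+ f g (x ∷ xs) = trans (cong (f x + g x +_) (sum-map-+ f g xs)) (+-comm-middle (f x) (g x) _ _)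
  where
  +-comm-middle : ∀ a b c d → (a + b) + (c + d) ≡ (a + c) + (b + d)
  +-comm-middle = solve-∀

∑-indicator : ∀ {k} (a : Fin k) → sum (map (λ c → if a == c then 1 else 0) (allFin k)) ≡ 1
∑-indicator {suc k} Fin.zero    = trans (sum-allFin-suc {k} (λ c → if Fin.zero == c then 1 else 0)) (cong suc (sum-zeros (allFin k)))
∑-indicator {suc k} (Fin.suc a) = trans (sum-allFin-suc {k} (λ c → if Fin.suc a == c then 1 else 0)) (∑-indicator a)

length-filterᵇ-∷ : ∀ {A : Set} (p : A → Bool) x xs → length (filterᵇ p (x ∷ xs)) ≡ (if p x then 1 else 0) + length (filterᵇ p xs)
length-filterᵇ-∷ p x xs with p x
... | true  = refl
... | false = refl

∑-length-classes : ∀ {A : Set} {k} (g : A → Fin k) xs →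
                   sum (map (λ c → length (filterᵇ (λ x → g x == c) xs)) (allFin k)) ≡ length xs
∑-length-classes {k = k} g []       = sum-zeros (allFin k)
∑-length-classes {k = k} g (x ∷ xs) = begin
  sum (map (λ c → length (filterᵇ (λ y → g y == c) (x ∷ xs))) (allFin k))
    ≡⟨ cong sum (List.map-cong (λ c → length-filterᵇ-∷ (λ y → g y == c) x xs) (allFin k)) ⟩
  sum (map (λ c → (if g x == c then 1 else 0) + length (filterᵇ (λ y → g y == c) xs)) (allFin k))
    ≡⟨ sum-map-+ (λ c → if g x == c then 1 else 0) (λ c → length (filterᵇ (λ y → g y == c) xs)) (allFin k) ⟩
  sum (map (λ c → if g x == c then 1 else 0) (allFin k)) + sum (map (λ c → length (filterᵇ (λ y → g y == c) xs)) (allFin k))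
    ≡⟨ cong₂ _+_ (∑-indicator (g x)) (∑-length-classes g xs) ⟩
  suc (length xs) ∎
  where open ≡-Reasoning

∑-length-colourClass : ∀ {k n} (col : Decomposition k n) → sum (map (λ c → length (colourClass col c)) (allFin k)) ≡ n C 2
∑-length-colourClass {n = n} col = trans (∑-length-classes (λ e → col (proj₁ e) (proj₂ e)) (allEdges n)) (length-allEdges n)

-- The upper bound

Mad≤Φ : ∀ P {n} (G : Graph n) → G ⊆ allEdges n → Mad G ≤ℚ ratio (Φ (suc P) (length G + suc P C 2)) (suc (suc P))
Mad≤Φ P G G⊆ = Mad-lub G λ S F F⊆G inside-S →
  ratio-≤ (2 * length F) ∣ S ∣ (Φ (suc P) (length G + suc P C 2)) (suc P)
    (Φ-density P (length-mono-≤ F⊆G) (length-subgraph S (⊆-trans F⊆G G⊆) inside-S))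

shifted-edge-count : ∀ {n} k P q r → n C 2 ≡ k * (suc P C 2) + q * suc P + r →
                     n C 2 + k * (suc P C 2) ≡ r + (k * P + q) * suc P
shifted-edge-count {n} k P q r nC2≡ = begin
  n C 2 + k * (suc P C 2)                               ≡⟨ cong (_+ k * (suc P C 2)) nC2≡ ⟩
  (k * (suc P C 2) + q * suc P + r) + k * (suc P C 2)   ≡⟨ regroup k (suc P C 2) q (suc P) r ⟩
  r + q * suc P + k * (2 * (suc P C 2))                 ≡⟨ cong (λ m → r + q * suc P + k * m) (2*[1+n]C2≡[1+n]*n P) ⟩
  r + q * suc P + k * (suc P * P)                       ≡⟨ factor k P q r ⟩
  r + (k * P + q) * suc P                               ∎
  where
  open ≡-Reasoning
  regroup : ∀ k c q p r → (k * c + q * p + r) + k * c ≡ r + q * p + k * (2 * c)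
  regroup = solve-∀
  factor : ∀ k P q r → r + q * suc P + k * (suc P * P) ≡ r + (k * P + q) * suc P
  factor = solve-∀

sumMad≤ : ∀ {k n} P q r → n C 2 ≡ k * (suc P C 2) + q * suc P + r → r < suc P → (col : Decomposition k n) →
          sumMad col ≤ℚ ratio (suc (suc P) * (k * P + q) + excess (suc P) r) (suc (suc P))
sumMad≤ {k} {n} P q r nC2≡ r<p col = begin
  sumMad col
    ≤⟨ sumℚ-mono-≤ (allFin k) (λ c → Mad≤Φ P (colourClass col c) (filter-⊆ (T? ∘ _) (allEdges n))) ⟩
  foldr ℚ._+_ 0ℚ (map (λ c → ratio (Φ (suc P) (e c + suc P C 2)) (suc (suc P))) (allFin k))
    ≡⟨ sumℚ-ratio (λ c → Φ (suc P) (e c + suc P C 2)) (suc P) (allFin k) ⟩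
  ratio (sum (map (λ c → Φ (suc P) (e c + suc P C 2)) (allFin k))) (suc (suc P))
    ≤⟨ ratio-mono-≤ (suc P) (Φ-sum P e (suc P C 2) (allFin k)) ⟩
  ratio (Φ (suc P) (sum (map e (allFin k)) + length (allFin k) * (suc P C 2))) (suc (suc P))
    ≡⟨ cong₂ (λ m l → ratio (Φ (suc P) (m + l * (suc P C 2))) (suc (suc P)))
             (∑-length-colourClass col) (List.length-tabulate {n = k} id) ⟩
  ratio (Φ (suc P) (n C 2 + k * (suc P C 2))) (suc (suc P))
    ≡⟨ cong (λ m → ratio (Φ (suc P) m) (suc (suc P))) (shifted-edge-count {n} k P q r nC2≡) ⟩
  ratio (Φ (suc P) (r + (k * P + q) * suc P)) (suc (suc P))
    ≡⟨ cong (λ m → ratio m (suc (suc P))) (Φ-spec (k * P + q) r<p) ⟩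
  ratio (suc (suc P) * (k * P + q) + excess (suc P) r) (suc (suc P)) ∎
  where
  open ℚ.≤-Reasoning
  e : Fin k → ℕ
  e c = length (colourClass col c)

excess+gap : ∀ {P r} → suc P ≤ 2 * r + 1 → r ≤ suc P → excess (suc P) r + 2 * (suc P ∸ r) ≡ suc (suc P)
excess+gap {P} {r} p≤2r+1 r≤p = +-cancelˡ-≡ (suc P) _ _ (begin
  suc P + (x + 2 * d)  ≡⟨ +-assoc (suc P) x (2 * d) ⟨
  (suc P + x) + 2 * d  ≡⟨ cong (_+ 2 * d) (m+[n∸m]≡n p≤2r+1) ⟩
  (2 * r + 1) + 2 * d  ≡⟨ regroup r d ⟩
  2 * (d + r) + 1      ≡⟨ cong (λ m → 2 * m + 1) (m∸n+n≡m r≤p) ⟩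
  2 * suc P + 1        ≡⟨ double P ⟩
  suc P + suc (suc P)  ∎)
  where
  open ≡-Reasoning
  x = excess (suc P) r
  d = suc P ∸ r
  regroup : ∀ r d → (2 * r + 1) + 2 * d ≡ 2 * (d + r) + 1
  regroup = solve-∀
  double : ∀ P → 2 * suc P + 1 ≡ suc P + suc (suc P)
  double = solve-∀

bound≡ratio : ∀ k P q r → r < suc P →
              bound k (suc P) q r ≡ ratio (suc (suc P) * (k * P + q) + excess (suc P) r) (suc (suc P))
bound≡ratio k P q r r<p with 2 * r + 1 ≤ᵇ suc P in test
... | true = begin
  ratio (k * suc P + q) 1 ℚ.- ratio k 1
    ≡⟨ cong (λ m → ratio m 1 ℚ.- ratio k 1) (split-k k P q) ⟩
  ratio (k * P + q + k) 1 ℚ.- ratio k 1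
    ≡⟨ ratio-+-cancelʳ (k * P + q) k 0 ⟩
  ratio (k * P + q) 1
    ≡⟨ ratio-≡ (k * P + q) 0 (suc (suc P) * (k * P + q) + 0) (suc P) (scale (suc (suc P)) (k * P + q)) ⟩
  ratio (suc (suc P) * (k * P + q) + 0) (suc (suc P))
    ≡⟨ cong (λ x → ratio (suc (suc P) * (k * P + q) + x) (suc (suc P))) no-excess ⟨
  ratio (suc (suc P) * (k * P + q) + excess (suc P) r) (suc (suc P)) ∎
  where
  open ≡-Reasoning
  no-excess : excess (suc P) r ≡ 0
  no-excess = m≤n⇒m∸n≡0 (≤ᵇ⇒≤ (2 * r + 1) (suc P) (subst T (sym test) _))
  split-k : ∀ k P q → k * suc P + q ≡ k * P + q + k
  split-k = solve-∀
  scale : ∀ s y → y * s ≡ (s * y + 0) * 1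
  scale = solve-∀
... | false = begin
  (ratio (k * suc P + q + 1) 1 ℚ.- ratio k 1) ℚ.- ratio D (suc (suc P))
    ≡⟨ cong (λ m → (ratio m 1 ℚ.- ratio k 1) ℚ.- ratio D (suc (suc P))) (split-k k P q) ⟩
  (ratio (k * P + q + 1 + k) 1 ℚ.- ratio k 1) ℚ.- ratio D (suc (suc P))
    ≡⟨ cong (ℚ._- ratio D (suc (suc P))) (ratio-+-cancelʳ (k * P + q + 1) k 0) ⟩
  ratio (k * P + q + 1) 1 ℚ.- ratio D (suc (suc P))
    ≡⟨ cong (ℚ._- ratio D (suc (suc P))) (ratio-≡ (k * P + q + 1) 0 (V + D) (suc P) whole) ⟩
  ratio (V + D) (suc (suc P)) ℚ.- ratio D (suc (suc P))
    ≡⟨ ratio-+-cancelʳ V D (suc P) ⟩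
  ratio V (suc (suc P)) ∎
  where
  open ≡-Reasoning
  D = 2 * (suc P ∸ r)
  V = suc (suc P) * (k * P + q) + excess (suc P) r
  p<2r+1 : suc P < 2 * r + 1
  p<2r+1 = ≰⇒> (λ le → subst T test (≤⇒≤ᵇ le))
  split-k : ∀ k P q → k * suc P + q + 1 ≡ k * P + q + 1 + k
  split-k = solve-∀
  scale : ∀ s y → (y + 1) * s ≡ (s * y + s) * 1
  scale = solve-∀
  whole : (k * P + q + 1) * suc (suc P) ≡ (V + D) * 1
  whole = begin
    (k * P + q + 1) * suc (suc P)
      ≡⟨ scale (suc (suc P)) (k * P + q) ⟩
    (suc (suc P) * (k * P + q) + suc (suc P)) * 1
      ≡⟨ cong (λ m → (suc (suc P) * (k * P + q) + m) * 1) (excess+gap (<⇒≤ p<2r+1) (<⇒≤ r<p)) ⟨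
    (suc (suc P) * (k * P + q) + (excess (suc P) r + D)) * 1
      ≡⟨ cong (_* 1) (+-assoc (suc (suc P) * (k * P + q)) (excess (suc P) r) D) ⟨
    (V + D) * 1 ∎

-- The lower bound

-- (P + 2) times the Mad of part i of a decomposition of the prescribed shape.
partValue : (k P q r i : ℕ) → ℕ
partValue k P q r i = suc (suc P) * P + (if i <ᵇ q then suc (suc P) else if suc i <ᵇ k then 0 else excess (suc P) r)

∑-partValue : ∀ P r k q → q < k → sum (map (partValue k P q r ∘ toℕ) (allFin k)) ≡ suc (suc P) * (k * P + q) + excess (suc P) r
∑-partValue P r k q q<k = trans (tiers k q q<k) (regroup (suc (suc P)) k P q (excess (suc P) r))
  where
  regroup : ∀ s k P q x → k * (s * P) + q * s + x ≡ s * (k * P + q) + x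
  regroup = solve-∀
  tiers : ∀ k q → q < k → sum (map (partValue k P q r ∘ toℕ) (allFin k)) ≡ k * (suc (suc P) * P) + q * suc (suc P) + excess (suc P) r
  tiers (suc zero) zero _ = last (suc (suc P) * P) (excess (suc P) r)
    where
    last : ∀ v x → v + x + 0 ≡ 1 * v + 0 * suc (suc P) + x
    last = solve-∀
  tiers (suc (suc k)) zero _ = trans (sum-allFin-suc {suc k} (partValue (suc (suc k)) P zero r ∘ toℕ))
    (trans (cong (λ m → suc (suc P) * P + 0 + m) (tiers (suc k) zero (s≤s z≤n))) (step (suc (suc P) * P) k (excess (suc P) r)))
    where
    step : ∀ v k x → v + 0 + (suc k * v + 0 * suc (suc P) + x) ≡ suc (suc k) * v + 0 * suc (suc P) + x
    step = solve-∀
  tiers (suc k) (suc q) (s≤s q<k) = trans (sum-allFin-suc {k} (partValue (suc k) P (suc q) r ∘ toℕ))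
    (trans (cong (λ m → suc (suc P) * P + suc (suc P) + m) (tiers k q q<k)) (step (suc (suc P) * P) (suc (suc P)) k q (excess (suc P) r)))
    where
    step : ∀ v s k q x → v + s + (k * v + q * s + x) ≡ suc k * v + suc q * s + x
    step = solve-∀

module _ {n : ℕ} (Pc : Edge n → Bool) where

  private
    G : Graph n
    G = filterᵇ Pc (allEdges n)

  clique-value≤Mad : ∀ {m} t → ContainsK G (suc m) → ratio (suc t * m) (suc t) ≤ℚ Mad G
  clique-value≤Mad {m} t K = subst (_≤ℚ Mad G)
    (ratio-≡ (2 * (suc m C 2)) m (suc t * m) t (trans (cong (_* suc t) (2*[1+n]C2≡[1+n]*n m)) (swap (suc m) m (suc t))))
    (clique-density≤Mad Pc K)
    where
    swap : ∀ a b c → a * b * c ≡ c * b * a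
    swap = solve-∀

  Kₚ-value≤Mad : ∀ P → IsCopyOfK G (suc P) → ratio (suc (suc P) * P + 0) (suc (suc P)) ≤ℚ Mad G
  Kₚ-value≤Mad P copy = subst (λ v → ratio v (suc (suc P)) ≤ℚ Mad G) (sym (+-identityʳ (suc (suc P) * P)))
    (clique-value≤Mad (suc P) (touched G , copy))

  module _ (P r : ℕ) where

    clique-case : 2 * r + 1 ≤ suc P → ContainsK G (suc P) →
                  ratio (suc (suc P) * P + excess (suc P) r) (suc (suc P)) ≤ℚ Mad G
    clique-case 2r+1≤p K rewrite m≤n⇒m∸n≡0 2r+1≤p | +-identityʳ (suc (suc P) * P) = clique-value≤Mad (suc P) K

    spread-case : suc P ≤ 2 * r + 1 → length G ≡ suc P C 2 + r → nVert G ≡ suc (suc P) →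
                  ratio (suc (suc P) * P + excess (suc P) r) (suc (suc P)) ≤ℚ Mad G
    spread-case p≤2r+1 size spread = subst₂ (λ a s → ratio a s ≤ℚ Mad G) twice-size spread (touched-density≤Mad G)
      where
      open ≡-Reasoning
      x = excess (suc P) r
      P+x≡2r : P + x ≡ 2 * r
      P+x≡2r = +-cancelʳ-≡ 1 _ _ (trans (+-comm (P + x) 1) (m+[n∸m]≡n p≤2r+1))
      twice-size : 2 * length G ≡ suc (suc P) * P + x
      twice-size = begin
        2 * length G             ≡⟨ cong (2 *_) size ⟩
        2 * (suc P C 2 + r)      ≡⟨ *-distribˡ-+ 2 (suc P C 2) r ⟩
        2 * (suc P C 2) + 2 * r  ≡⟨ cong₂ _+_ (2*[1+n]C2≡[1+n]*n P) (sym P+x≡2r) ⟩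
        suc P * P + (P + x)      ≡⟨ +-assoc (suc P * P) P x ⟨
        suc P * P + P + x        ≡⟨ cong (_+ x) (+-comm (suc P * P) P) ⟩
        suc (suc P) * P + x      ∎

  family-value≤Mad : ∀ P r → InFamily (suc P) r G → ratio (suc (suc P) * P + excess (suc P) r) (suc (suc P)) ≤ℚ Mad G
  family-value≤Mad P r (size , shape) with 2 * r + 1 <ᵇ suc P in test₁ | suc P <ᵇ 2 * r + 1 in test₂
  ... | true  | _     = clique-case P r (<⇒≤ (<ᵇ⇒< _ _ (subst T (sym test₁) _))) shape
  ... | false | true  = spread-case P r (<⇒≤ (<ᵇ⇒< _ _ (subst T (sym test₂) _))) size shape
  ... | false | false with shape
  ...   | inj₁ K      = clique-case P r (≮⇒≥ (λ lt → subst T test₂ (<⇒<ᵇ lt))) K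
  ...   | inj₂ spread = spread-case P r (≮⇒≥ (λ lt → subst T test₁ (<⇒<ᵇ lt))) size spread

  -- The Booleans are those tested by partSpec and partValue: part index < q, r = 0, part is not the last one.
  part-value≤Mad : ∀ P r b₁ b₂ b₃ → (T b₂ → r ≡ 0) →
    (if b₁ then IsCopyOfK G (suc (suc P)) else if b₂ then IsCopyOfK G (suc P)
     else if b₃ then IsCopyOfK G (suc P) else InFamily (suc P) r G) →
    ratio (suc (suc P) * P + (if b₁ then suc (suc P) else if b₃ then 0 else excess (suc P) r)) (suc (suc P)) ≤ℚ Mad G
  part-value≤Mad P r true  _     _     _   copy   =
    subst (λ v → ratio v (suc (suc P)) ≤ℚ Mad G) (regroup P) (clique-value≤Mad (suc P) (touched G , copy))
    where
    regroup : ∀ P → suc (suc P) * suc P ≡ suc (suc P) * P + suc (suc P)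
    regroup = solve-∀
  part-value≤Mad P r false true  true  _   copy   = Kₚ-value≤Mad P copy
  part-value≤Mad P r false true  false r≡0 copy rewrite r≡0 _ | 0∸n≡0 P = Kₚ-value≤Mad P copy
  part-value≤Mad P r false false true  _   copy   = Kₚ-value≤Mad P copy
  part-value≤Mad P r false false false _   family = family-value≤Mad P r family

ratio≤sumMad : ∀ {k n} P q r → q < k → (col : Decomposition k n) → (∀ c → partSpec k (suc P) q r c (colourClass col c)) →
               ratio (suc (suc P) * (k * P + q) + excess (suc P) r) (suc (suc P)) ≤ℚ sumMad col
ratio≤sumMad {k} P q r q<k col spec = begin
  ratio (suc (suc P) * (k * P + q) + excess (suc P) r) (suc (suc P))
    ≡⟨ cong (λ v → ratio v (suc (suc P))) (∑-partValue P r k q q<k) ⟨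
  ratio (sum (map (partValue k P q r ∘ toℕ) (allFin k))) (suc (suc P))
    ≡⟨ sumℚ-ratio (partValue k P q r ∘ toℕ) (suc P) (allFin k) ⟨
  foldr ℚ._+_ 0ℚ (map (λ c → ratio (partValue k P q r (toℕ c)) (suc (suc P))) (allFin k))
    ≤⟨ sumℚ-mono-≤ (allFin k) (λ c → part-value≤Mad (λ e → col (proj₁ e) (proj₂ e) == c) P r
                                        (toℕ c <ᵇ q) (r ≡ᵇ 0) (suc (toℕ c) <ᵇ k) (≡ᵇ⇒≡ r 0) (spec c)) ⟩
  sumMad col ∎
  where open ℚ.≤-Reasoning

theorem5p2 : (n k p q r : ℕ) → 3 ≤ n → 2 ≤ k → k ≤ n C 2 →
    k * (p C 2) ≤ n C 2 → n C 2 < k * (suc p C 2) →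
    n C 2 ≡ k * (p C 2) + q * p + r → q < k → r < p →
    ((col : Decomposition k n) → sumMad col ≤ℚ bound k p q r) ×
    (AdmitsDecomposition k n p q r →
    Σ (Decomposition k n) λ col → sumMad col ≡ bound k p q r)
theorem5p2 n k zero    q r _ _ _ _ _ _     _   ()
theorem5p2 n k (suc P) q r _ _ _ _ _ nC2≡ q<k r<p =
  upper , λ (col , spec) → col , ℚ.≤-antisym (upper col) (lower col spec)
  where
  upper : (col : Decomposition k n) → sumMad col ≤ℚ bound k (suc P) q r
  upper col = subst (sumMad col ≤ℚ_) (sym (bound≡ratio k P q r r<p)) (sumMad≤ P q r nC2≡ r<p col)
  lower : (col : Decomposition k n) → (∀ c → partSpec k (suc P) q r c (colourClass col c)) → bound k (suc P) q r ≤ℚ sumMad col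
  lower col spec = subst (_≤ℚ sumMad col) (sym (bound≡ratio k P q r r<p)) (ratio≤sumMad P q r q<k col spec)
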